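{- Let $k\ge2$, let $G_1=(V_1,E_1)$, $G_2=(V_2,E_2)$ be undirected graphs with initial colorings $\chi,\chi'$, and let $u,v\in V_1$, $u',v'\in V_2$. If the bijective $k$-walk pebble game distinguishes $(u,v)$ from $(u',v')$ in $m$ rounds, then $m$ iterations of $k$-walk refinement distinguish them, i.e. $\chi_{\mathcal{W}[k]}^m(u,v)\ne\chi'^{\,m}_{\mathcal{W}[k]}(u',v')$.
   Context: Initial coloring: $\chi(v,v)=-1$, $\chi(u,v)=1$ for adjacent $u\ne v$, $0$ otherwise. $k$-walk refinement: $\chi_{\mathcal{W}[k]}(u,v)=\{\!\{(\chi(u,w_1),\chi(w_1,w_2),\dots,\chi(w_{k-1},v)): w_i\in V\}\!\}$, with colors as formal objects comparable across graphs; superscript $m$ denotes $m$-fold iteration. Bijective $k$-walk pebble game on $G_1,G_2$: pebble pairs $(p_i,q_i)$, $i\in[k+1]$; pairs $i,i+1$ ($i\in[k]$) and $k+1,1$ are consecutive. If $|V_1|\ne|V_2|$ Spoiler wins immediately. Each round: (1) if pebbles are on the graphs, Spoiler chooses a pair $(p_i,q_i)$, relabels it $(p_1,q_1)$ and relabels the next consecutive pair, if placed, $(p_{k+1},q_{k+1})$, then removes all other pairs; (2) Duplicator chooses a bijection $f\colon V_1^{k-1}\to V_2^{k-1}$; (3) Spoiler chooses $(u_2,\dots,u_k)\in V_1^{k-1}$, places $p_i$ on $u_i$ and $q_i$ on $v_i$ where $f(u_2,\dots,u_k)=(v_2,\dots,v_k)$. Spoiler wins after a round if some consecutive pebble pairs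 lie on $(a,b)\in V_1^2$ and $(a',b')\in V_2^2$ with $a\mapsto a',b\mapsto b'$ not an isomorphism $G_1[\{a,b\}]\to G_2[\{a',b'\}]$. The game distinguishes $(u,v)$ from $(u',v')$ in $m$ rounds if, in the modified game with $(p_1,q_1)$ initially on $(u,u')$ and $(p_{k+1},q_{k+1})$ on $(v,v')$ and the first round starting with Duplicator's move, Spoiler can force a win after at most $m$ rounds; it distinguishes them in $0$ rounds if $(u,v),(u',v')$ are of different types among loop, edge, non-edge. -}

module Defs where

open import Data.Nat using (ℕ; zero; suc; _∸_)
open import Data.Integer using (ℤ; +_; -[1+_])
open import Data.Bool using (Bool; true; false; if_then_else_)
open import Data.Fin using (Fin; zero; suc; inject₁)
import Data.Fin as Fin
open import Data.Vec using (Vec; _∷_; _∷ʳ_; lookup)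
open import Data.Product using (Σ; Σ-syntax; _×_; _,_; proj₁; proj₂)
open import Data.Sum using (_⊎_)
open import Relation.Nullary using (¬_; yes; no)
open import Relation.Binary.PropositionalEquality using (_≡_; _≢_)
open import Function.Bundles using (_⤖_; Bijection)

record Graph : Set where
  field
    n     : ℕ
    adj   : Fin n → Fin n → Bool
    sym   : ∀ x y → adj x y ≡ adj y x
    irrefl : ∀ x → adj x x ≡ false
open Graph public

V : Graph → Set
V G = Fin (n G)

χ : (G : Graph) → V G → V G → ℤ
χ G a b with a Fin.≟ b
... | yes _ = -[1+ 0 ]
... | no _  = if adj G a b then + 1 else + 0

data AType : Set where
  loop edge nonedge : AType

atype : (G : Graph) → V G → V G → AType
atype G a b with a Fin.≟ b
... | yes _ = loop
... | no _  = if adj G a b then edge else nonedge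

consec : ∀ {A : Set} {l} → Vec A (suc l) → Fin l → A × A
consec xs i = lookup xs (inject₁ i) , lookup xs (suc i)

-- Intermediate vertices (w₁,…,w_{k-1}) of a k-walk.
Tuples : ℕ → Graph → Set
Tuples k G = Vec (V G) (k ∸ 1)

walk : ∀ {A : Set} {l} → A → Vec A l → A → Vec A (suc (suc l))
walk a w b = a ∷ (w ∷ʳ b)

-- The closed cycle of the k+1 pebble positions p₁,…,p_{k+1}, back to p₁
-- (k+1 consecutive pairs, the last one being (p_{k+1}, p₁)).
cycle : ∀ {A : Set} {l} → A → Vec A l → A → Vec A (suc (suc (suc l)))
cycle a w b = walk a w b ∷ʳ a

-- SameColor k m G H u v u' v' :  χ^m_{W[k]}(u,v) = χ'^m_{W[k]}(u',v').
-- Level 0 is the initial coloring; at level m+1 the colors are multisets of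
-- k-tuples of level-m colors along walks, and equality of these multisets is
-- spelled out as the existence of a bijection between the walk index sets
-- V^{k-1} matching tuples componentwise.
SameColor : ℕ → ℕ → (G H : Graph) → V G → V G → V H → V H → Set
SameColor k zero    G H u v u' v' = χ G u v ≡ χ H u' v'
SameColor k (suc m) G H u v u' v' =
  Σ[ g ∈ (Tuples k G ⤖ Tuples k H) ]
    ((w : Tuples k G) → (i : Fin (suc (k ∸ 1))) →
      SameColor k m G H
        (proj₁ (consec (walk u w v) i)) (proj₂ (consec (walk u w v) i))
        (proj₁ (consec (walk u' (Bijection.to g w) v') i))
        (proj₂ (consec (walk u' (Bijection.to g w) v') i)))

PartIso : (G H : Graph) → V G × V G → V H × V H → Set
PartIso G H (a , b) (a' , b') =
  ((a ≡ b → a' ≡ b') × (a' ≡ b' → a ≡ b)) × (adj G a b ≡ adj H a' b')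

-- SpoilerWins k m G H (a,b) (a',b'): in the bijective k-walk pebble game with
-- (p₁,q₁) on (a,a') and (p_{k+1},q_{k+1}) on (b,b'), the round starting with
-- Duplicator's move, Spoiler can force a win after at most m rounds.
-- m = 0: the pairs have different atomic types.
-- m+1: for every bijection f chosen by Duplicator, Spoiler picks w; either some
-- consecutive pebble pair violates the partial isomorphism condition (win after
-- this round), or Spoiler keeps some consecutive pair (i, i+1) (or (k+1,1)),
-- relabels it (p₁, p_{k+1}), and wins from there within m rounds.
SpoilerWins : ℕ → ℕ → (G H : Graph) → V G × V G → V H × V H → Set
SpoilerWins k zero    G H (a , b) (a' , b') = atype G a b ≢ atype H a' b'
SpoilerWins k (suc m) G H (a , b) (a' , b') =
  (f : Tuples k G ⤖ Tuples k H) →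
  Σ[ w ∈ Tuples k G ]
    ((Σ[ i ∈ Fin (suc (suc (k ∸ 1))) ]
        ¬ PartIso G H (consec (cycle a w b) i)
                      (consec (cycle a' (Bijection.to f w) b') i))
     ⊎
     (Σ[ i ∈ Fin (suc (suc (k ∸ 1))) ]
        SpoilerWins k m G H (consec (cycle a w b) i)
                            (consec (cycle a' (Bijection.to f w) b') i)))

Distinguishes : ℕ → ℕ → (G H : Graph) → V G → V G → V H → V H → Set
Distinguishes k m G H u v u' v' = SpoilerWins k m G H (u , v) (u' , v')

{-# OPTIONS --safe #-}
-- If (u,v) and (u',v') have equal colors after m+1 rounds, the
-- bijection witnessing this is a strategy for Duplicator: whatever Spoiler picks,
-- every consecutive pebble pair of the resulting cycle gets equal m-round colors.
-- For the pairs along the walk this is the definition; for the closing pair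
-- (v,u),(v',u') it holds because colors refine (m+1 rounds determine m rounds)
-- and are symmetric (reverse the walks). Equal colors imply equal initial colors,
-- hence a partial isomorphism, so Spoiler neither wins now nor, by induction, later.
module Submission where

open import Defs hiding (sym)
open import Data.Nat using (ℕ; zero; suc; _∸_; _≤_)
open import Data.Integer using (ℤ; +_; -[1+_])
open import Data.Bool using (Bool; true; false)
open import Data.Fin using (Fin; zero; suc; inject₁; fromℕ; opposite)
import Data.Fin as Fin
open import Data.Vec using (Vec; []; _∷_; _∷ʳ_; lookup; replicate; reverse)
open import Data.Vec.Properties using (reverse-∷; reverse-involutive)
open import Data.Product using (_×_; _,_; proj₁; proj₂; swap; uncurry)
open import Data.Sum using (inj₁; inj₂)
open import Data.Empty using (⊥-elim)
open import Relation.Nullary using (¬_; yes; no)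
open import Relation.Binary.PropositionalEquality
  using (_≡_; refl; sym; trans; cong; cong₂; subst₂; module ≡-Reasoning)
open import Function.Bundles using (_⤖_; Bijection; mk↔ₛ′)
open import Function.Properties.Inverse using (↔⇒⤖)
open import Function.Construct.Composition using (_⤖-∘_)

data InjectOrLast : ∀ {n} → Fin (suc n) → Set where
  inject : ∀ {n} (j : Fin n) → InjectOrLast (inject₁ j)
  last   : ∀ {n} → InjectOrLast (fromℕ n)

injectOrLast : ∀ {n} (i : Fin (suc n)) → InjectOrLast i
injectOrLast {zero}  zero    = last
injectOrLast {suc n} zero    = inject zero
injectOrLast {suc n} (suc i) with injectOrLast i
... | inject j = inject (suc j)
... | last     = last

opposite-inject₁ : ∀ {n} (i : Fin n) → opposite (inject₁ i) ≡ suc (opposite i)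
opposite-inject₁ zero    = refl
opposite-inject₁ (suc i) = cong inject₁ (opposite-inject₁ i)

opposite-fromℕ : ∀ n → opposite (fromℕ n) ≡ zero
opposite-fromℕ zero    = refl
opposite-fromℕ (suc n) = cong inject₁ (opposite-fromℕ n)

module _ {A : Set} where

  lookup-∷ʳ-inject₁ : ∀ {n} (xs : Vec A n) y (i : Fin n) →
                      lookup (xs ∷ʳ y) (inject₁ i) ≡ lookup xs i
  lookup-∷ʳ-inject₁ (x ∷ xs) y zero    = refl
  lookup-∷ʳ-inject₁ (x ∷ xs) y (suc i) = lookup-∷ʳ-inject₁ xs y i

  lookup-∷ʳ-fromℕ : ∀ {n} (xs : Vec A n) y → lookup (xs ∷ʳ y) (fromℕ n) ≡ y
  lookup-∷ʳ-fromℕ []       y = refl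
  lookup-∷ʳ-fromℕ (x ∷ xs) y = lookup-∷ʳ-fromℕ xs y

  reverse-∷ʳ : ∀ {n} (xs : Vec A n) y → reverse (xs ∷ʳ y) ≡ y ∷ reverse xs
  reverse-∷ʳ []       y = refl
  reverse-∷ʳ (x ∷ xs) y = begin
    reverse (x ∷ (xs ∷ʳ y))    ≡⟨ reverse-∷ x (xs ∷ʳ y) ⟩
    reverse (xs ∷ʳ y) ∷ʳ x     ≡⟨ cong (_∷ʳ x) (reverse-∷ʳ xs y) ⟩
    y ∷ (reverse xs ∷ʳ x)      ≡⟨ cong (y ∷_) (reverse-∷ x xs) ⟨
    y ∷ reverse (x ∷ xs)       ∎
    where open ≡-Reasoning

  lookup-reverse : ∀ {n} (xs : Vec A n) i → lookup (reverse xs) i ≡ lookup xs (opposite i)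
  lookup-reverse (x ∷ xs) i rewrite reverse-∷ x xs with injectOrLast i
  ... | inject j = begin
    lookup (reverse xs ∷ʳ x) (inject₁ j) ≡⟨ lookup-∷ʳ-inject₁ (reverse xs) x j ⟩
    lookup (reverse xs) j                ≡⟨ lookup-reverse xs j ⟩
    lookup xs (opposite j)               ≡⟨ cong (lookup (x ∷ xs)) (opposite-inject₁ j) ⟨
    lookup (x ∷ xs) (opposite (inject₁ j)) ∎
    where open ≡-Reasoning
  ... | last = trans (lookup-∷ʳ-fromℕ (reverse xs) x)
                     (cong (lookup (x ∷ xs)) (sym (opposite-fromℕ _)))

  reverse⤖ : ∀ {n} → Vec A n ⤖ Vec A n
  reverse⤖ = ↔⇒⤖ (mk↔ₛ′ reverse reverse reverse-involutive reverse-involutive)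

  consec-∷ʳ-inject₁ : ∀ {n} (xs : Vec A (suc n)) y (i : Fin n) →
                      consec (xs ∷ʳ y) (inject₁ i) ≡ consec xs i
  consec-∷ʳ-inject₁ xs y i =
    cong₂ _,_ (lookup-∷ʳ-inject₁ xs y (inject₁ i)) (lookup-∷ʳ-inject₁ xs y (suc i))

  consec-reverse : ∀ {n} (xs : Vec A (suc n)) i →
                   consec (reverse xs) i ≡ swap (consec xs (opposite i))
  consec-reverse xs i = cong₂ _,_
    (trans (lookup-reverse xs (inject₁ i)) (cong (lookup xs) (opposite-inject₁ i)))
    (lookup-reverse xs (suc i))

  reverse-walk : ∀ {n} a (w : Vec A n) b → reverse (walk a w b) ≡ walk b (reverse w) a
  reverse-walk a w b = begin
    reverse (a ∷ (w ∷ʳ b))      ≡⟨ reverse-∷ a (w ∷ʳ b) ⟩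
    reverse (w ∷ʳ b) ∷ʳ a       ≡⟨ cong (_∷ʳ a) (reverse-∷ʳ w b) ⟩
    b ∷ (reverse w ∷ʳ a)        ∎
    where open ≡-Reasoning

  consec-walk-reverse : ∀ {n} a (w : Vec A n) b i →
    consec (walk b (reverse w) a) i ≡ swap (consec (walk a w b) (opposite i))
  consec-walk-reverse a w b i =
    trans (cong (λ xs → consec xs i) (sym (reverse-walk a w b))) (consec-reverse (walk a w b) i)

  consec-cycle-last : ∀ {n} a (w : Vec A n) b → consec (cycle a w b) (fromℕ (suc n)) ≡ (b , a)
  consec-cycle-last {n} a w b =
    cong₂ _,_ (trans (lookup-∷ʳ-inject₁ (walk a w b) a (fromℕ (suc n))) (lookup-∷ʳ-fromℕ (a ∷ w) b))
              (lookup-∷ʳ-fromℕ (walk a w b) a)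

  IsLoop : A × A → Set
  IsLoop (a , b) = a ≡ b

  walk-replicate-loop : ∀ {n} (a b : A) (j : Fin n) → consec (walk a (replicate n a) b) (inject₁ j) ≡ (a , a)
  walk-replicate-loop a b zero    = refl
  walk-replicate-loop a b (suc j) = walk-replicate-loop a b j

  walk-replicate-last : ∀ n (a b : A) → consec (walk a (replicate n a) b) (fromℕ n) ≡ (a , b)
  walk-replicate-last zero    a b = refl
  walk-replicate-last (suc n) a b = walk-replicate-last n a b

  walk-loops-last : ∀ {n} a (w : Vec A n) b →
    (∀ j → IsLoop (consec (walk a w b) (inject₁ j))) → consec (walk a w b) (fromℕ n) ≡ (a , b)
  walk-loops-last a []      b loops = refl
  walk-loops-last a (x ∷ w) b loops rewrite loops zero = walk-loops-last x w b (λ j → loops (suc j))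

χ⇒atype : ℤ → AType
χ⇒atype -[1+ 0 ] = loop
χ⇒atype (+ 1)    = edge
χ⇒atype _        = nonedge

χ⇒adj : ℤ → Bool
χ⇒adj (+ 1) = true
χ⇒adj _     = false

module _ (G : Graph) where

  χ-refl : ∀ a → χ G a a ≡ -[1+ 0 ]
  χ-refl a with a Fin.≟ a
  ... | yes _  = refl
  ... | no a≢a = ⊥-elim (a≢a refl)

  χ≡-1⇒≡ : ∀ {a b} → χ G a b ≡ -[1+ 0 ] → a ≡ b
  χ≡-1⇒≡ {a} {b} with a Fin.≟ b
  ... | yes a≡b = λ _ → a≡b
  ... | no _ with adj G a b
  ...   | true  = λ ()
  ...   | false = λ ()

  χ-sym : ∀ a b → χ G a b ≡ χ G b a
  χ-sym a b with a Fin.≟ b | b Fin.≟ a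
  ... | yes _   | yes _   = refl
  ... | yes a≡b | no b≢a  = ⊥-elim (b≢a (sym a≡b))
  ... | no a≢b  | yes b≡a = ⊥-elim (a≢b (sym b≡a))
  ... | no _    | no _    rewrite Graph.sym G a b = refl

  atype-χ : ∀ a b → atype G a b ≡ χ⇒atype (χ G a b)
  atype-χ a b with a Fin.≟ b
  ... | yes _ = refl
  ... | no _ with adj G a b
  ...   | true  = refl
  ...   | false = refl

  adj-χ : ∀ a b → adj G a b ≡ χ⇒adj (χ G a b)
  adj-χ a b with a Fin.≟ b
  ... | yes refl = irrefl G a
  ... | no _ with adj G a b
  ...   | true  = refl
  ...   | false = refl

module _ {G H : Graph} {a b : V G} {a' b' : V H} (χ≡ : χ G a b ≡ χ H a' b') where

  χ≡⇒atype≡ : atype G a b ≡ atype H a' b'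
  χ≡⇒atype≡ = trans (atype-χ G a b) (trans (cong χ⇒atype χ≡) (sym (atype-χ H a' b')))

  χ≡⇒PartIso : PartIso G H (a , b) (a' , b')
  χ≡⇒PartIso = (loop⇒loop' , loop'⇒loop) , adj≡
    where
    loop⇒loop' : a ≡ b → a' ≡ b'
    loop⇒loop' refl = χ≡-1⇒≡ H (trans (sym χ≡) (χ-refl G a))
    loop'⇒loop : a' ≡ b' → a ≡ b
    loop'⇒loop refl = χ≡-1⇒≡ G (trans χ≡ (χ-refl H a'))
    adj≡ : adj G a b ≡ adj H a' b'
    adj≡ = trans (adj-χ G a b) (trans (cong χ⇒adj χ≡) (sym (adj-χ H a' b')))

SameColor₂ : ℕ → ℕ → (G H : Graph) → V G × V G → V H × V H → Set
SameColor₂ k m G H p q = SameColor k m G H (proj₁ p) (proj₂ p) (proj₁ q) (proj₂ q)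

module _ {k : ℕ} {G H : Graph} where

  SameColor⇒χ≡ : ∀ m {a b a' b'} → SameColor k m G H a b a' b' → χ G a b ≡ χ H a' b'
  SameColor-suc⇒SameColor : ∀ m {a b a' b'} →
    SameColor k (suc m) G H a b a' b' → SameColor k m G H a b a' b'

  SameColor⇒χ≡ zero    same = same
  SameColor⇒χ≡ (suc m) same = SameColor⇒χ≡ m (SameColor-suc⇒SameColor m same)

  -- The constant walk u,…,u,v must be matched by a walk whose first k-1 steps
  -- are loops, i.e. by u',…,u',v'; comparing last steps gives the claim.
  SameColor-suc⇒SameColor m {u} {v} {u'} {v'} (g , same) =
    subst₂ (SameColor₂ k m G H)
      (walk-replicate-last (k ∸ 1) u v) (walk-loops-last u' (Bijection.to g w) v' image-loops)
      (same w (fromℕ (k ∸ 1)))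
    where
    w : Tuples k G
    w = replicate _ u
    image-loops : ∀ j → IsLoop (consec (walk u' (Bijection.to g w) v') (inject₁ j))
    image-loops j = χ≡-1⇒≡ H (begin
      uncurry (χ H) (consec (walk u' (Bijection.to g w) v') (inject₁ j))
        ≡⟨ SameColor⇒χ≡ m (same w (inject₁ j)) ⟨
      uncurry (χ G) (consec (walk u w v) (inject₁ j))
        ≡⟨ cong (uncurry (χ G)) (walk-replicate-loop u v j) ⟩
      χ G u u
        ≡⟨ χ-refl G u ⟩
      -[1+ 0 ] ∎)
      where open ≡-Reasoning

  SameColor-swap : ∀ m {a b a' b'} → SameColor k m G H a b a' b' → SameColor k m G H b a b' a'
  SameColor-swap zero    {a} {b} {a'} {b'} χ≡ = trans (χ-sym G b a) (trans χ≡ (χ-sym H a' b'))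
  SameColor-swap (suc m) {a} {b} {a'} {b'} (g , same) = reverse⤖ ⤖-∘ (g ⤖-∘ reverse⤖) , same-reversed
    where
    same-reversed : ∀ w i → SameColor₂ k m G H (consec (walk b w a) i)
      (consec (walk b' (reverse (Bijection.to g (reverse w))) a') i)
    same-reversed w i = subst₂ (SameColor₂ k m G H)
      (sym (trans (cong (λ x → consec (walk b x a) i) (sym (reverse-involutive w)))
                  (consec-walk-reverse a (reverse w) b i)))
      (sym (consec-walk-reverse a' (Bijection.to g (reverse w)) b' i))
      (SameColor-swap m (same (reverse w) (opposite i)))

  SameColor-cycle : ∀ m {a b a' b'} (same : SameColor k (suc m) G H a b a' b') (w : Tuples k G) i →
    SameColor₂ k m G H (consec (cycle a w b) i) (consec (cycle a' (Bijection.to (proj₁ same) w) b') i)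
  SameColor-cycle m {a} {b} {a'} {b'} same w i with injectOrLast i
  ... | inject j = subst₂ (SameColor₂ k m G H)
    (sym (consec-∷ʳ-inject₁ (walk a w b) a j))
    (sym (consec-∷ʳ-inject₁ (walk a' (Bijection.to (proj₁ same) w) b') a' j))
    (proj₂ same w j)
  ... | last = subst₂ (SameColor₂ k m G H)
    (sym (consec-cycle-last a w b))
    (sym (consec-cycle-last a' (Bijection.to (proj₁ same) w) b'))
    (SameColor-swap m (SameColor-suc⇒SameColor m same))

lemma17 : (k : ℕ) → 2 ≤ k → (G₁ G₂ : Graph) → (m : ℕ) →
    (u v : V G₁) → (u' v' : V G₂) →
    Distinguishes k m G₁ G₂ u v u' v' →
    ¬ SameColor k m G₁ G₂ u v u' v'
lemma17 k _ G₁ G₂ zero u v u' v' types-differ same = types-differ (χ≡⇒atype≡ {a = u} {v} {u'} {v'} same)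
lemma17 k 2≤k G₁ G₂ (suc m) u v u' v' spoiler-wins same with spoiler-wins (proj₁ same)
... | w , inj₁ (i , ¬iso) = ¬iso (χ≡⇒PartIso (SameColor⇒χ≡ m (SameColor-cycle m same w i)))
... | w , inj₂ (i , wins) = lemma17 k 2≤k G₁ G₂ m _ _ _ _ wins (SameColor-cycle m same w i)
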